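{- For $n\ge 1$ let $d^{AS}_n$ denote the number of derangements $\sigma\in S_n$ whose length $\mathrm{inv}(\sigma)$ is even. Then: (i) For $n\ge 2$, $\displaystyle d^{AS}_n=\frac{n!}{2}\sum_{k=0}^{n-2}\frac{(-1)^k}{k!}+(-1)^{n-1}(n-1)$. (ii) For $n\ge 2$, $\displaystyle d^{AS}_n=n\,d^{AS}_{n-1}+\frac{(-1)^{n-1}}{2}(n-2)(n+1)$, with $d^{AS}_1=0$. (iii) For $n\ge 3$, $d^{AS}_n=(n-1)\bigl(d^{AS}_{n-1}+d^{AS}_{n-2}+(-1)^{n-1}\bigr)$, with $d^{AS}_1=d^{AS}_2=0$.
   Context: $S_n$ is the symmetric group of permutations $\sigma=\sigma_1\cdots\sigma_n$ of $[n]=\{1,\dots,n\}$. A derangement is a permutation with $\sigma_i\neq i$ for all $i$. The length of $\sigma$ (as a Coxeter group element with simple transpositions as generators) is $\mathrm{inv}(\sigma)=\#\{(i,j): i<j,\ \sigma_i>\sigma_j\}$. -}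

module Defs where

open import Data.Nat using (ℕ; zero; suc; _+_; _*_; _∸_; _<?_; _%_; _!)
open import Data.Nat.Properties using (_!≢0)
open import Data.Fin using (Fin; toℕ)
open import Data.Fin.Properties using (all?; _≟_)
open import Data.Vec using (Vec; []; _∷_; lookup)
open import Data.List using (List; []; _∷_; [_]; map; concatMap; filter; length; allFin; upTo; foldr)
open import Data.Product using (_×_; _,_; proj₁; proj₂)
open import Relation.Nullary using (Dec; yes; no; ¬_; _×-dec_; ¬?)
open import Data.Empty using (⊥-elim)
open import Relation.Binary.PropositionalEquality using (_≡_; _≢_)
open import Data.Integer using (ℤ; +_)
open import Data.Rational using (ℚ; _/_; -_; 1ℚ; 0ℚ) renaming (_+_ to _+ℚ_; _*_ to _*ℚ_)
import Data.Nat as ℕ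

allWords : (k n : ℕ) → List (Vec (Fin n) k)
allWords zero    n = [ [] ]
allWords (suc k) n = concatMap (λ i → map (i ∷_) (allWords k n)) (allFin n)

-- σ (in one-line notation) is a permutation of [n] iff the map i ↦ σᵢ is injective.
IsPerm : ∀ {n} → Vec (Fin n) n → Set
IsPerm {n} σ = (i j : Fin n) → lookup σ i ≡ lookup σ j → i ≡ j

isPerm? : ∀ {n} (σ : Vec (Fin n) n) → Dec (IsPerm σ)
isPerm? σ = all? λ i → all? λ j → dec i j
  where
  dec : ∀ i j → Dec (lookup σ i ≡ lookup σ j → i ≡ j)
  dec i j with lookup σ i ≟ lookup σ j | i ≟ j
  ... | _ | yes p = yes (λ _ → p)
  ... | no q | _ = yes (λ e → ⊥-elim (q e))
  ... | yes e | no q = no (λ f → q (f e))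

IsDerangement : ∀ {n} → Vec (Fin n) n → Set
IsDerangement {n} σ = (i : Fin n) → lookup σ i ≢ i

isDerangement? : ∀ {n} (σ : Vec (Fin n) n) → Dec (IsDerangement σ)
isDerangement? σ = all? λ i → ¬? (lookup σ i ≟ i)

allPairs : (n : ℕ) → List (Fin n × Fin n)
allPairs n = concatMap (λ i → map (i ,_) (allFin n)) (allFin n)

inv : ∀ {n} → Vec (Fin n) n → ℕ
inv {n} σ = length (filter (λ p → (toℕ (proj₁ p) <? toℕ (proj₂ p))
                                  ×-dec (toℕ (lookup σ (proj₂ p)) <? toℕ (lookup σ (proj₁ p))))
                           (allPairs n))

EvenLength : ∀ {n} → Vec (Fin n) n → Set
EvenLength σ = inv σ % 2 ≡ 0

evenLength? : ∀ {n} (σ : Vec (Fin n) n) → Dec (EvenLength σ)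
evenLength? σ = (inv σ % 2) ℕ.≟ 0

dAS : ℕ → ℕ
dAS n = length (filter (λ σ → isPerm? σ ×-dec (isDerangement? σ ×-dec evenLength? σ))
                       (allWords n n))

signℚ : ℕ → ℚ
signℚ zero    = 1ℚ
signℚ (suc k) = - signℚ k

ℕtoℚ : ℕ → ℚ
ℕtoℚ m = (+ m) / 1

invFact : ℕ → ℚ
invFact k = _/_ (+ 1) (k !) {{k !≢0}}

altSum : ℕ → ℚ
altSum m = foldr (λ k acc → (signℚ k *ℚ invFact k) +ℚ acc) 0ℚ (upTo (suc m))

-- Let e m and o m count the derangements of [m] with an even, resp. odd, number of
-- inversions.  Classify permutations by their first entry a: it contributes exactly a
-- inversions, and deleting it leaves a permutation of the remaining values.  For a
-- derangement starting with q + 1 the remaining positions must still avoid their own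
-- (renumbered) values, except position q, which has become free; swapping positions
-- q - 1 and q, ..., 0 and 1 moves the free position to the front and flips the parity q
-- times.  The permutations of [m] that are fixed-point free except possibly at 0 split by
-- their first entry in the same way, which yields the coupled recurrences
--   e (m + 2) = (m + 1) (o (m + 1) + o m),   o (m + 2) = (m + 1) (e (m + 1) + e m).
-- So D = e + o is the derangement number, D m = m! Σ_{k ≤ m} (-1)^k / k!, while
-- Δ = e - o satisfies Δ (m + 2) = -(m + 1) (Δ (m + 1) + Δ m), whence Δ (m + 1) = (-1)^m m.
-- The three formulas are ring identities in e = (D + Δ) / 2.

module Submission where

open import Defs

open import Algebra.Bundles using (CommutativeMonoid)
import Algebra.Properties.CommutativeSemigroup as CommSemigroupProperties
open import Data.Bool using (Bool; true; false; not; _∧_; _∨_; if_then_else_; T)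
open import Data.Bool.Properties using (T-≡; T-∨; T-∧; T-not-≡; ∨-commutativeMonoid; ∧-commutativeMonoid)
open import Data.Fin using (Fin; toℕ; punchIn) renaming (zero to fzero; suc to fsuc)
open import Data.Fin.Properties using (toℕ<n; toℕ≤pred[n]; toℕ-injective; suc-injective; 0≢1+n)
import Data.Integer as ℤ
import Data.Integer.Properties as ℤ
open import Data.List
  using (List; []; _∷_; _∷ʳ_; _++_; length; filter; map; foldr; upTo; concatMap; tabulate; allFin)
open import Data.List.Properties using (upTo-∷ʳ; foldr-∷ʳ)
open import Data.Maybe using (Maybe; nothing; just; _>>=_)
import Data.Maybe as Maybe
open import Data.Nat
  using (ℕ; zero; suc; _+_; _*_; _∸_; _%_; _!; _≤_; _<_; z≤n; s≤s; _≡ᵇ_; _<ᵇ_; parity)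
import Data.Nat as ℕ
import Data.Nat.Coprimality as Coprime
open import Data.Nat.Properties
  using ( +-0-monoid; +-0-commutativeMonoid; +-commutativeSemigroup; +-comm; +-suc; +-identityʳ
        ; +-mono-≤; +-monoʳ-≤; ≤-trans; ≤-reflexive; ≤-antisym; <-trans; n<1+n; n≤1+n; m≤n⇒m≤1+n
        ; ≤⇒≯; ≮⇒≥; m<1+n⇒m<n∨m≡n; ≡⇒≡ᵇ; ≡ᵇ⇒≡; <⇒<ᵇ; <ᵇ⇒<
        ; m+[n∸m]≡n; m∸[m∸n]≡n; ∸-monoʳ-≤; m+n∸n≡m; _!≢0; module ≤-Reasoning )
open import Data.Parity.Base using (Parity; 0ℙ; 1ℙ; _⁻¹)
import Data.Parity.Base as ℙ
open import Data.Parity.Properties using (_≟_; ⁻¹-involutive; suc-homo-⁻¹; +-homo-+)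
open import Data.Product using (∃; _×_; _,_; proj₁; proj₂)
import Data.Product as Product
open import Data.Rational using (ℚ; mkℚ; ½; 0ℚ; 1ℚ; -_) renaming (_+_ to _+ℚ_; _*_ to _*ℚ_)
import Data.Rational.Properties as ℚ
open import Data.Rational.Solver using (module +-*-Solver)
open import Data.Sum using (inj₁; inj₂)
open import Data.Unit using (tt)
open import Data.Vec using (Vec; []; _∷_; toList; lookup) renaming (map to vmap)
open import Data.Vec.Properties using (length-toList)
open import Function using (_∘_; id)
open import Function.Bundles using (module Equivalence; _⇔_; mk⇔)
open import Relation.Binary.PropositionalEquality
open import Relation.Nullary using (¬_; Dec; does; proof; contradiction)
open import Relation.Nullary.Reflects using (det; fromEquivalence)

open import Algebra.Properties.CommutativeMonoid.Sum +-0-commutativeMonoid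
  using (sum-syntax; sum-cong-≗; sum-remove; ∑-comm; sum-replicate)
open import Algebra.Properties.Monoid.Mult +-0-monoid using () renaming (_×_ to _×ℕ_)
open CommSemigroupProperties (CommutativeMonoid.commutativeSemigroup ∨-commutativeMonoid)
  using () renaming (x∙yz≈y∙xz to ∨-leftComm)
open CommSemigroupProperties (CommutativeMonoid.commutativeSemigroup ∧-commutativeMonoid)
  using () renaming (x∙yz≈y∙xz to ∧-leftComm)
open CommSemigroupProperties +-commutativeSemigroup using () renaming (x∙yz≈y∙xz to +-leftComm)
open +-*-Solver using (solve; _:+_; _:*_; :-_; _:=_; con)

count : ∀ {A : Set} → (A → Bool) → List A → ℕ
count p []       = 0
count p (x ∷ xs) = if p x then suc (count p xs) else count p xs

module _ {A : Set} where

  count-cong : ∀ {p q : A → Bool} → (∀ x → p x ≡ q x) → ∀ xs → count p xs ≡ count q xs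
  count-cong p≗q []       = refl
  count-cong p≗q (x ∷ xs) rewrite p≗q x = cong (λ c → if _ then suc c else c) (count-cong p≗q xs)

  count-none : ∀ {p : A → Bool} → (∀ x → p x ≡ false) → ∀ xs → count p xs ≡ 0
  count-none p≡false []       = refl
  count-none p≡false (x ∷ xs) rewrite p≡false x = count-none p≡false xs

  count-++ : ∀ (p : A → Bool) xs ys → count p (xs ++ ys) ≡ count p xs + count p ys
  count-++ p []       ys = refl
  count-++ p (x ∷ xs) ys with p x
  ... | true  = cong suc (count-++ p xs ys)
  ... | false = count-++ p xs ys

  count-map : ∀ {B : Set} (p : A → Bool) (f : B → A) xs → count p (map f xs) ≡ count (p ∘ f) xs
  count-map p f []       = refl
  count-map p f (x ∷ xs) with p (f x)
  ... | true  = cong suc (count-map p f xs)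
  ... | false = count-map p f xs

  count-concatMap-tabulate : ∀ {B : Set} (p : A → Bool) (f : B → List A) n (g : Fin n → B) →
    count p (concatMap f (tabulate g)) ≡ ∑[ i < n ] count p (f (g i))
  count-concatMap-tabulate p f zero    g = refl
  count-concatMap-tabulate p f (suc n) g = trans (count-++ p (f (g fzero)) _)
    (cong (count p (f (g fzero)) +_) (count-concatMap-tabulate p f n (g ∘ fsuc)))

  count-mono : ∀ {p q : A → Bool} → (∀ x → T (p x) → T (q x)) → ∀ xs → count p xs ≤ count q xs
  count-mono p⇒q []       = z≤n
  count-mono {p} {q} p⇒q (x ∷ xs) with p x | q x | p⇒q x
  ... | true  | true  | _   = s≤s (count-mono p⇒q xs)
  ... | true  | false | p⇒q = contradiction tt p⇒q
  ... | false | true  | _   = m≤n⇒m≤1+n (count-mono p⇒q xs)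
  ... | false | false | _   = count-mono p⇒q xs

  count-∨ : ∀ (p q : A → Bool) xs → count (λ x → p x ∨ q x) xs ≤ count p xs + count q xs
  count-∨ p q []       = z≤n
  count-∨ p q (x ∷ xs) with p x | q x
  ... | true  | true  = s≤s (≤-trans (count-∨ p q xs) (+-monoʳ-≤ (count p xs) (n≤1+n _)))
  ... | true  | false = s≤s (count-∨ p q xs)
  ... | false | true  = ≤-trans (s≤s (count-∨ p q xs)) (≤-reflexive (sym (+-suc _ _)))
  ... | false | false = count-∨ p q xs

  count-complement : ∀ (p : A → Bool) xs → count p xs + count (not ∘ p) xs ≡ length xs
  count-complement p []       = refl
  count-complement p (x ∷ xs) with p x
  ... | true  = cong suc (count-complement p xs)
  ... | false = trans (+-suc _ _) (cong suc (count-complement p xs))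

count-tabulate : ∀ {A : Set} (p : A → Bool) k (g : Fin k → A) →
  count p (tabulate g) ≡ ∑[ j < k ] (if p (g j) then 1 else 0)
count-tabulate p zero    g = refl
count-tabulate p (suc k) g with p (g fzero)
... | true  = cong suc (count-tabulate p k (g ∘ fsuc))
... | false = count-tabulate p k (g ∘ fsuc)

length-filter : ∀ {A : Set} {P : A → Set} (P? : ∀ x → Dec (P x)) xs →
  length (filter P? xs) ≡ count (does ∘ P?) xs
length-filter P? []       = refl
length-filter P? (x ∷ xs) with does (P? x)
... | true  = cong suc (length-filter P? xs)
... | false = length-filter P? xs

≡ᵇ-sym : ∀ x y → (x ≡ᵇ y) ≡ (y ≡ᵇ x)
≡ᵇ-sym zero    zero    = refl
≡ᵇ-sym zero    (suc y) = refl
≡ᵇ-sym (suc x) zero    = refl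
≡ᵇ-sym (suc x) (suc y) = ≡ᵇ-sym x y

<ᵇ-connex : ∀ x y → (x ≡ᵇ y) ≡ false → (y <ᵇ x) ≡ not (x <ᵇ y)
<ᵇ-connex zero    (suc y) _   = refl
<ᵇ-connex (suc x) zero    _   = refl
<ᵇ-connex (suc x) (suc y) x≢y = <ᵇ-connex x y x≢y

T-not : ∀ {b} → T (not b) ⇔ (¬ T b)
T-not {true}  = mk⇔ (λ ()) (λ ¬tt → ¬tt tt)
T-not {false} = mk⇔ (λ _ ()) (λ _ → tt)

does-≡ : ∀ {P : Set} (P? : Dec P) {b} → (T b → P) → (P → T b) → does P? ≡ b
does-≡ P? sound complete = det (proof P?) (fromEquivalence sound complete)

≟-+-transpose : ∀ x q p → does (x ℙ.+ q ≟ p) ≡ does (q ≟ x ℙ.+ p)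
≟-+-transpose 0ℙ q  p  = refl
≟-+-transpose 1ℙ 0ℙ 0ℙ = refl
≟-+-transpose 1ℙ 0ℙ 1ℙ = refl
≟-+-transpose 1ℙ 1ℙ 0ℙ = refl
≟-+-transpose 1ℙ 1ℙ 1ℙ = refl

parity-suc : ∀ m → parity (suc m) ≡ parity m ⁻¹
parity-suc m = trans (sym (⁻¹-involutive (parity (suc m)))) (cong _⁻¹ (suc-homo-⁻¹ m))

parity-suc-leftComm : ∀ x y z → parity (suc (x + (y + z))) ≡ parity (y + (x + z)) ⁻¹
parity-suc-leftComm x y z = trans (parity-suc (x + (y + z))) (cong (λ m → parity m ⁻¹) (+-leftComm x y z))

⁻¹-+-comm : ∀ x p → x ⁻¹ ℙ.+ p ≡ x ℙ.+ p ⁻¹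
⁻¹-+-comm 0ℙ p = refl
⁻¹-+-comm 1ℙ p = sym (⁻¹-involutive p)

module _ {n : ℕ} where

  _∈ᵇ_ : ∀ {k} → Fin n → Vec (Fin n) k → Bool
  a ∈ᵇ []      = false
  a ∈ᵇ (x ∷ w) = (toℕ a ≡ᵇ toℕ x) ∨ (a ∈ᵇ w)

  #entries : ∀ {k} → (ℕ → Bool) → Vec (Fin n) k → ℕ
  #entries P w = count (P ∘ toℕ) (toList w)

  distinct : ∀ {k} → Vec (Fin n) k → Bool
  distinct []      = true
  distinct (a ∷ w) = not (a ∈ᵇ w) ∧ distinct w

  #below : ∀ {k} → ℕ → Vec (Fin n) k → ℕ
  #below t = #entries (_<ᵇ t)

  inversions : ∀ {k} → Vec (Fin n) k → ℕ
  inversions []      = 0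
  inversions (a ∷ w) = #below (toℕ a) w + inversions w

avoids : Maybe ℕ → ℕ → Bool
avoids nothing  v = true
avoids (just u) v = not (v ≡ᵇ u)

-- f i is the value forbidden at position i, if any.
avoidsAll : ∀ {n k} → (ℕ → Maybe ℕ) → Vec (Fin n) k → Bool
avoidsAll f []      = true
avoidsAll f (a ∷ w) = avoids (f 0) (toℕ a) ∧ avoidsAll (f ∘ suc) w

#entries-cong : ∀ {n k} {P Q : ℕ → Bool} → (∀ x → P x ≡ Q x) → (w : Vec (Fin n) k) →
  #entries P w ≡ #entries Q w
#entries-cong P≗Q w = count-cong (P≗Q ∘ toℕ) (toList w)

avoidsAll-cong : ∀ {n k} {f g : ℕ → Maybe ℕ} → (∀ i → f i ≡ g i) → (w : Vec (Fin n) k) →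
  avoidsAll f w ≡ avoidsAll g w
avoidsAll-cong f≗g []      = refl
avoidsAll-cong f≗g (a ∷ w) = cong₂ (λ u b → avoids u (toℕ a) ∧ b) (f≗g 0) (avoidsAll-cong (f≗g ∘ suc) w)

#words : (k n : ℕ) → (Vec (Fin n) k → Bool) → ℕ
#words k n p = count p (allWords k n)

#words-cong : ∀ k n {p q : Vec (Fin n) k → Bool} → (∀ w → p w ≡ q w) → #words k n p ≡ #words k n q
#words-cong k n p≗q = count-cong p≗q (allWords k n)

#words-none : ∀ k n {p : Vec (Fin n) k → Bool} → (∀ w → p w ≡ false) → #words k n p ≡ 0
#words-none k n p≡false = count-none p≡false (allWords k n)

#words-if : ∀ k n b (p : Vec (Fin n) k → Bool) →
  #words k n (λ w → if b then p w else false) ≡ (if b then #words k n p else 0)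
#words-if k n true  p = refl
#words-if k n false p = #words-none k n (λ _ → refl)

#words-∷ : ∀ k n (p : Vec (Fin n) (suc k) → Bool) →
  #words (suc k) n p ≡ ∑[ i < n ] #words k n (p ∘ (i ∷_))
#words-∷ k n p = trans (count-concatMap-tabulate p (λ i → map (i ∷_) (allWords k n)) n id)
                       (sum-cong-≗ (λ i → count-map p (i ∷_) (allWords k n)))

#words-punchIn : ∀ k n (a : Fin (suc n)) (p : Vec (Fin (suc n)) k → Bool) →
  (∀ w → T (a ∈ᵇ w) → p w ≡ false) → #words k (suc n) p ≡ #words k n (p ∘ vmap (punchIn a))
#words-punchIn zero    n a p a∈⇒false = refl
#words-punchIn (suc k) n a p a∈⇒false = begin
    #words (suc k) (suc n) p
  ≡⟨ #words-∷ k (suc n) p ⟩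
    ∑[ i < suc n ] #words k (suc n) (p ∘ (i ∷_))
  ≡⟨ sum-remove {i = a} (λ i → #words k (suc n) (p ∘ (i ∷_))) ⟩
    #words k (suc n) (p ∘ (a ∷_)) + ∑[ j < n ] #words k (suc n) (p ∘ (punchIn a j ∷_))
  ≡⟨ cong₂ _+_ (#words-none k (suc n) (λ w → a∈⇒false (a ∷ w) (a∈a∷ w)))
               (sum-cong-≗ λ j → #words-punchIn k n a (p ∘ (punchIn a j ∷_)) (λ w → a∈⇒false _ ∘ a∈x∷ w)) ⟩
    ∑[ j < n ] #words k n (p ∘ (punchIn a j ∷_) ∘ vmap (punchIn a))
  ≡⟨ #words-∷ k n (p ∘ vmap (punchIn a)) ⟨
    #words (suc k) n (p ∘ vmap (punchIn a))
  ∎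
  where
  open ≡-Reasoning
  a∈a∷ : ∀ w → T (a ∈ᵇ (a ∷ w))
  a∈a∷ w = Equivalence.from T-∨ (inj₁ (≡⇒≡ᵇ (toℕ a) (toℕ a) refl))
  a∈x∷ : ∀ {x} w → T (a ∈ᵇ w) → T (a ∈ᵇ (x ∷ w))
  a∈x∷ w = Equivalence.from T-∨ ∘ inj₂

swapAdjacent : ∀ {A : Set} {k} → ℕ → Vec A k → Vec A k
swapAdjacent zero    (a ∷ b ∷ w) = b ∷ a ∷ w
swapAdjacent (suc j) (a ∷ w)     = a ∷ swapAdjacent j w
swapAdjacent _       w           = w

#words-swapAdjacent : ∀ j k n (p : Vec (Fin n) k → Bool) →
  #words k n (λ w → p (swapAdjacent j w)) ≡ #words k n p
#words-swapAdjacent zero    zero          n p = refl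
#words-swapAdjacent zero    (suc zero)    n p = #words-cong 1 n λ { (a ∷ []) → refl }
#words-swapAdjacent zero    (suc (suc k)) n p = begin
    #words (2 + k) n (λ w → p (swapAdjacent 0 w))
  ≡⟨ #words-∷ (suc k) n (λ w → p (swapAdjacent 0 w)) ⟩
    ∑[ i < n ] #words (suc k) n (λ w → p (swapAdjacent 0 (i ∷ w)))
  ≡⟨ sum-cong-≗ (λ i → #words-∷ k n (λ w → p (swapAdjacent 0 (i ∷ w)))) ⟩
    ∑[ i < n ] ∑[ i′ < n ] #words k n (λ w → p (i′ ∷ i ∷ w))
  ≡⟨ ∑-comm (λ i i′ → #words k n (λ w → p (i′ ∷ i ∷ w))) ⟩
    ∑[ i′ < n ] ∑[ i < n ] #words k n (λ w → p (i′ ∷ i ∷ w))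
  ≡⟨ sum-cong-≗ (λ i′ → #words-∷ k n (p ∘ (i′ ∷_))) ⟨
    ∑[ i′ < n ] #words (suc k) n (p ∘ (i′ ∷_))
  ≡⟨ #words-∷ (suc k) n p ⟨
    #words (2 + k) n p
  ∎
  where open ≡-Reasoning
#words-swapAdjacent (suc j) zero    n p = refl
#words-swapAdjacent (suc j) (suc k) n p =
  trans (#words-∷ k n (λ w → p (swapAdjacent (suc j) w)))
        (trans (sum-cong-≗ (λ i → #words-swapAdjacent j k n (p ∘ (i ∷_)))) (sym (#words-∷ k n p)))

-- Deleting a value from the alphabet

punchInℕ : ℕ → ℕ → ℕ
punchInℕ zero    v       = suc v
punchInℕ (suc a) zero    = zero
punchInℕ (suc a) (suc v) = suc (punchInℕ a v)

-- The value u renumbered after deleting the value a (nothing when u = a).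
punchOut? : ℕ → ℕ → Maybe ℕ
punchOut? zero    zero    = nothing
punchOut? zero    (suc u) = just u
punchOut? (suc a) zero    = just zero
punchOut? (suc a) (suc u) = Maybe.map suc (punchOut? a u)

toℕ-punchIn : ∀ {n} (a : Fin (suc n)) j → toℕ (punchIn a j) ≡ punchInℕ (toℕ a) (toℕ j)
toℕ-punchIn fzero    j        = refl
toℕ-punchIn (fsuc a) fzero    = refl
toℕ-punchIn (fsuc a) (fsuc j) = cong suc (toℕ-punchIn a j)

punchInℕ-≡ᵇ : ∀ a x y → (punchInℕ a x ≡ᵇ punchInℕ a y) ≡ (x ≡ᵇ y)
punchInℕ-≡ᵇ zero    x       y       = refl
punchInℕ-≡ᵇ (suc a) zero    zero    = refl
punchInℕ-≡ᵇ (suc a) zero    (suc y) = refl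
punchInℕ-≡ᵇ (suc a) (suc x) zero    = refl
punchInℕ-≡ᵇ (suc a) (suc x) (suc y) = punchInℕ-≡ᵇ a x y

punchInℕ-<ᵇ : ∀ a x y → (punchInℕ a x <ᵇ punchInℕ a y) ≡ (x <ᵇ y)
punchInℕ-<ᵇ zero    x       y       = refl
punchInℕ-<ᵇ (suc a) zero    zero    = refl
punchInℕ-<ᵇ (suc a) zero    (suc y) = refl
punchInℕ-<ᵇ (suc a) (suc x) zero    = refl
punchInℕ-<ᵇ (suc a) (suc x) (suc y) = punchInℕ-<ᵇ a x y

punchInℕ-<ᵇ-pivot : ∀ a x → (punchInℕ a x <ᵇ a) ≡ (x <ᵇ a)
punchInℕ-<ᵇ-pivot zero    x       = refl
punchInℕ-<ᵇ-pivot (suc a) zero    = refl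
punchInℕ-<ᵇ-pivot (suc a) (suc x) = punchInℕ-<ᵇ-pivot a x

punchInℕ-≢ : ∀ a x → (a ≡ᵇ punchInℕ a x) ≡ false
punchInℕ-≢ zero    x       = refl
punchInℕ-≢ (suc a) zero    = refl
punchInℕ-≢ (suc a) (suc x) = punchInℕ-≢ a x

avoids-punchInℕ : ∀ m a v → avoids m (punchInℕ a v) ≡ avoids (m >>= punchOut? a) v
avoids-punchInℕ nothing        a       v       = refl
avoids-punchInℕ (just zero)    zero    v       = refl
avoids-punchInℕ (just (suc u)) zero    v       = refl
avoids-punchInℕ (just zero)    (suc a) zero    = refl
avoids-punchInℕ (just zero)    (suc a) (suc v) = refl
avoids-punchInℕ (just (suc u)) (suc a) zero    with punchOut? a u
... | nothing = refl
... | just _  = refl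
avoids-punchInℕ (just (suc u)) (suc a) (suc v) with punchOut? a u | avoids-punchInℕ (just u) a v
... | nothing | eq = eq
... | just _  | eq = eq

module _ {n : ℕ} (a : Fin (suc n)) where

  private
    ι : ∀ {k} → Vec (Fin n) k → Vec (Fin (suc n)) k
    ι = vmap (punchIn a)

  ∈ᵇ-punchIn : ∀ {k} x (w : Vec (Fin n) k) → punchIn a x ∈ᵇ ι w ≡ x ∈ᵇ w
  ∈ᵇ-punchIn x []      = refl
  ∈ᵇ-punchIn x (y ∷ w)
    rewrite toℕ-punchIn a x | toℕ-punchIn a y | punchInℕ-≡ᵇ (toℕ a) (toℕ x) (toℕ y) =
    cong ((toℕ x ≡ᵇ toℕ y) ∨_) (∈ᵇ-punchIn x w)

  pivot-∉ᵇ-punchIn : ∀ {k} (w : Vec (Fin n) k) → a ∈ᵇ ι w ≡ false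
  pivot-∉ᵇ-punchIn []      = refl
  pivot-∉ᵇ-punchIn (y ∷ w) rewrite toℕ-punchIn a y | punchInℕ-≢ (toℕ a) (toℕ y) = pivot-∉ᵇ-punchIn w

  distinct-punchIn : ∀ {k} (w : Vec (Fin n) k) → distinct (ι w) ≡ distinct w
  distinct-punchIn []      = refl
  distinct-punchIn (x ∷ w) rewrite ∈ᵇ-punchIn x w = cong (not (x ∈ᵇ w) ∧_) (distinct-punchIn w)

  avoidsAll-punchIn : ∀ {k} f (w : Vec (Fin n) k) →
    avoidsAll f (ι w) ≡ avoidsAll (λ i → f i >>= punchOut? (toℕ a)) w
  avoidsAll-punchIn f []      = refl
  avoidsAll-punchIn f (x ∷ w) rewrite toℕ-punchIn a x =
    cong₂ _∧_ (avoids-punchInℕ (f 0) (toℕ a) (toℕ x)) (avoidsAll-punchIn (f ∘ suc) w)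

  #entries-punchIn : ∀ {k} P (w : Vec (Fin n) k) → #entries P (ι w) ≡ #entries (P ∘ punchInℕ (toℕ a)) w
  #entries-punchIn P []      = refl
  #entries-punchIn P (x ∷ w) rewrite toℕ-punchIn a x with P (punchInℕ (toℕ a) (toℕ x))
  ... | true  = cong suc (#entries-punchIn P w)
  ... | false = #entries-punchIn P w

  inversions-punchIn : ∀ {k} (w : Vec (Fin n) k) → inversions (ι w) ≡ inversions w
  inversions-punchIn []      = refl
  inversions-punchIn (x ∷ w) = cong₂ _+_ below (inversions-punchIn w)
    where
    below : #below (toℕ (punchIn a x)) (ι w) ≡ #below (toℕ x) w
    below rewrite toℕ-punchIn a x =
      trans (#entries-punchIn (_<ᵇ punchInℕ (toℕ a) (toℕ x)) w)
            (#entries-cong (λ y → punchInℕ-<ᵇ (toℕ a) y (toℕ x)) w)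

  #below-pivot-punchIn : ∀ {k} (w : Vec (Fin n) k) → #below (toℕ a) (ι w) ≡ #below (toℕ a) w
  #below-pivot-punchIn w =
    trans (#entries-punchIn (_<ᵇ toℕ a) w) (#entries-cong (punchInℕ-<ᵇ-pivot (toℕ a)) w)

-- Adjacent transpositions of positions

swapIndex : ℕ → ℕ → ℕ
swapIndex zero    zero          = 1
swapIndex zero    (suc zero)    = 0
swapIndex zero    (suc (suc i)) = suc (suc i)
swapIndex (suc j) zero          = zero
swapIndex (suc j) (suc i)       = suc (swapIndex j i)

module _ {n : ℕ} where

  ∈ᵇ-swapAdjacent : ∀ {k} j x (w : Vec (Fin n) k) → x ∈ᵇ swapAdjacent j w ≡ x ∈ᵇ w
  ∈ᵇ-swapAdjacent zero    x []          = refl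
  ∈ᵇ-swapAdjacent zero    x (a ∷ [])    = refl
  ∈ᵇ-swapAdjacent zero    x (a ∷ b ∷ w) = ∨-leftComm (toℕ x ≡ᵇ toℕ b) (toℕ x ≡ᵇ toℕ a) (x ∈ᵇ w)
  ∈ᵇ-swapAdjacent (suc j) x []          = refl
  ∈ᵇ-swapAdjacent (suc j) x (a ∷ w)     = cong ((toℕ x ≡ᵇ toℕ a) ∨_) (∈ᵇ-swapAdjacent j x w)

  distinct-swapAdjacent : ∀ {k} j (w : Vec (Fin n) k) → distinct (swapAdjacent j w) ≡ distinct w
  distinct-swapAdjacent zero    []          = refl
  distinct-swapAdjacent zero    (a ∷ [])    = refl
  distinct-swapAdjacent zero    (a ∷ b ∷ w) rewrite ≡ᵇ-sym (toℕ b) (toℕ a) with toℕ a ≡ᵇ toℕ b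
  ... | true  = refl
  ... | false = ∧-leftComm (not (b ∈ᵇ w)) (not (a ∈ᵇ w)) (distinct w)
  distinct-swapAdjacent (suc j) []          = refl
  distinct-swapAdjacent (suc j) (a ∷ w) rewrite ∈ᵇ-swapAdjacent j a w =
    cong (not (a ∈ᵇ w) ∧_) (distinct-swapAdjacent j w)

  avoidsAll-swapAdjacent : ∀ {k} j f (w : Vec (Fin n) k) → suc j < k →
    avoidsAll f (swapAdjacent j w) ≡ avoidsAll (f ∘ swapIndex j) w
  avoidsAll-swapAdjacent zero    f (a ∷ b ∷ w) _         = ∧-leftComm (avoids (f 0) (toℕ b)) (avoids (f 1) (toℕ a)) _
  avoidsAll-swapAdjacent zero    f (a ∷ [])    (s≤s ())
  avoidsAll-swapAdjacent (suc j) f (a ∷ w)     (s≤s j<k) =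
    cong (avoids (f 0) (toℕ a) ∧_) (avoidsAll-swapAdjacent j (f ∘ suc) w j<k)

  #entries-swapAdjacent : ∀ {k} j P (w : Vec (Fin n) k) → #entries P (swapAdjacent j w) ≡ #entries P w
  #entries-swapAdjacent zero    P []          = refl
  #entries-swapAdjacent zero    P (a ∷ [])    = refl
  #entries-swapAdjacent zero    P (a ∷ b ∷ w) with P (toℕ a) | P (toℕ b)
  ... | true  | true  = refl
  ... | true  | false = refl
  ... | false | true  = refl
  ... | false | false = refl
  #entries-swapAdjacent (suc j) P []          = refl
  #entries-swapAdjacent (suc j) P (a ∷ w) with P (toℕ a)
  ... | true  = cong suc (#entries-swapAdjacent j P w)
  ... | false = #entries-swapAdjacent j P w

module _ {n : ℕ} where

  parity-inversions-swap₀ : ∀ {k} a b (w : Vec (Fin n) k) → T (distinct (a ∷ b ∷ w)) →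
    parity (inversions (b ∷ a ∷ w)) ≡ parity (inversions (a ∷ b ∷ w)) ⁻¹
  parity-inversions-swap₀ a b w dist with toℕ a ≡ᵇ toℕ b in a≢b
  -- the case true is absurd, since it turns dist into T false
  ... | false rewrite <ᵇ-connex (toℕ a) (toℕ b) a≢b with toℕ a <ᵇ toℕ b
  ...   | true  = parity-suc-leftComm (#below (toℕ b) w) (#below (toℕ a) w) (inversions w)
  ...   | false = trans (sym (⁻¹-involutive _))
                        (cong _⁻¹ (sym (parity-suc-leftComm (#below (toℕ a) w) (#below (toℕ b) w) (inversions w))))

  parity-inversions-swapAdjacent : ∀ {k} j (w : Vec (Fin n) k) → suc j < k → T (distinct w) →
    parity (inversions (swapAdjacent j w)) ≡ parity (inversions w) ⁻¹
  parity-inversions-swapAdjacent zero    (a ∷ b ∷ w) _         dist = parity-inversions-swap₀ a b w dist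
  parity-inversions-swapAdjacent zero    (a ∷ [])    (s≤s ())
  parity-inversions-swapAdjacent (suc j) (a ∷ w)     (s≤s j<k) dist
    rewrite #entries-swapAdjacent j (_<ᵇ toℕ a) w
          | +-homo-+ (#below (toℕ a) w) (inversions (swapAdjacent j w))
          | +-homo-+ (#below (toℕ a) w) (inversions w)
          | parity-inversions-swapAdjacent j w j<k (proj₂ (Equivalence.to T-∧ dist))
          with parity (#below (toℕ a) w)
  ... | 0ℙ = refl
  ... | 1ℙ = refl

-- Pigeonhole counting of entries

inInterval : ℕ → ℕ → ℕ → Bool
inInterval lo zero    x = false
inInterval lo (suc d) x = inInterval lo d x ∨ (x ≡ᵇ lo + d)

inInterval-complete : ∀ lo d {x} → lo ≤ x → x < lo + d → T (inInterval lo d x)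
inInterval-complete lo zero    lo≤x x<lo+0 = contradiction (subst (_<_ _) (+-identityʳ lo) x<lo+0) (≤⇒≯ lo≤x)
inInterval-complete lo (suc d) {x} lo≤x x<lo+1+d with m<1+n⇒m<n∨m≡n (subst (x <_) (+-suc lo d) x<lo+1+d)
... | inj₁ x<lo+d = Equivalence.from T-∨ (inj₁ (inInterval-complete lo d lo≤x x<lo+d))
... | inj₂ x≡lo+d = Equivalence.from (T-∨ {inInterval lo d x}) (inj₂ (≡⇒≡ᵇ x (lo + d) x≡lo+d))

module _ {n : ℕ} where

  ∉ᵇ⇒#entries-≡ᵇ-0 : ∀ {k} x (w : Vec (Fin n) k) → x ∈ᵇ w ≡ false →
    ∀ {v} → toℕ x ≡ v → #entries (_≡ᵇ v) w ≡ 0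
  ∉ᵇ⇒#entries-≡ᵇ-0 x []      _   refl = refl
  ∉ᵇ⇒#entries-≡ᵇ-0 x (y ∷ w) x∉w refl rewrite ≡ᵇ-sym (toℕ y) (toℕ x) with toℕ x ≡ᵇ toℕ y
  ... | false = ∉ᵇ⇒#entries-≡ᵇ-0 x w x∉w refl

  #entries-≡ᵇ-distinct : ∀ {k} v (w : Vec (Fin n) k) → T (distinct w) → #entries (_≡ᵇ v) w ≤ 1
  #entries-≡ᵇ-distinct v []      _    = z≤n
  #entries-≡ᵇ-distinct v (x ∷ w) dist with toℕ x ≡ᵇ v in x≡v | Equivalence.to T-∧ dist
  ... | true  | x∉w , _ =
    let x≡v = ≡ᵇ⇒≡ _ _ (subst T (sym x≡v) tt)
    in s≤s (≤-reflexive (∉ᵇ⇒#entries-≡ᵇ-0 x w (Equivalence.to T-not-≡ x∉w) x≡v))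
  ... | false | _ , dist = #entries-≡ᵇ-distinct v w dist

  #entries-inInterval-distinct : ∀ {k} lo d (w : Vec (Fin n) k) → T (distinct w) →
    #entries (inInterval lo d) w ≤ d
  #entries-inInterval-distinct lo zero    w _    = ≤-reflexive (count-none (λ _ → refl) (toList w))
  #entries-inInterval-distinct lo (suc d) w dist = begin
    #entries (inInterval lo (suc d)) w                     ≤⟨ count-∨ _ _ (toList w) ⟩
    #entries (inInterval lo d) w + #entries (_≡ᵇ lo + d) w ≤⟨ +-mono-≤ (#entries-inInterval-distinct lo d w dist)
                                                                       (#entries-≡ᵇ-distinct (lo + d) w dist) ⟩
    d + 1                                                  ≡⟨ +-comm d 1 ⟩
    suc d                                                  ∎
    where open ≤-Reasoning

-- At most t entries lie below t and at most m ∸ t lie in [t, m); as the two counts add up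
-- to m, both bounds are attained.
#below-distinct : ∀ {m} t (w : Vec (Fin m) m) → T (distinct w) → t ≤ m → #below t w ≡ t
#below-distinct {m} t w dist t≤m = ≤-antisym #below≤ t≤#below
  where
  #below≤ : #below t w ≤ t
  #below≤ = ≤-trans (count-mono (λ x x<t → inInterval-complete 0 t z≤n (<ᵇ⇒< _ _ x<t)) (toList w))
                    (#entries-inInterval-distinct 0 t w dist)
  #above = #entries (λ x → not (x <ᵇ t)) w
  #above≤ : #above ≤ m ∸ t
  #above≤ = ≤-trans (count-mono above-inInterval (toList w)) (#entries-inInterval-distinct t (m ∸ t) w dist)
    where
    above-inInterval : ∀ (x : Fin m) → T (not (toℕ x <ᵇ t)) → T (inInterval t (m ∸ t) (toℕ x))
    above-inInterval x x≮t = inInterval-complete t (m ∸ t)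
      (≮⇒≥ (subst T (Equivalence.to T-not-≡ x≮t) ∘ <⇒<ᵇ))
      (subst (toℕ x <_) (sym (m+[n∸m]≡n t≤m)) (toℕ<n x))
  t≤#below : t ≤ #below t w
  t≤#below = begin
    t                           ≡⟨ m∸[m∸n]≡n t≤m ⟨
    m ∸ (m ∸ t)                 ≤⟨ ∸-monoʳ-≤ m #above≤ ⟩
    m ∸ #above                  ≡⟨ cong (_∸ #above) (trans (count-complement _ (toList w)) (length-toList w)) ⟨
    #below t w + #above ∸ #above ≡⟨ m+n∸n≡m (#below t w) #above ⟩
    #below t w                  ∎
    where open ≤-Reasoning

-- Permutations avoiding forbidden values, by inversion parity

forbiddenAfter : (ℕ → Maybe ℕ) → ℕ → ℕ → Maybe ℕ
forbiddenAfter f a i = f (suc i) >>= punchOut? a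

isPermAvoiding : ∀ {m} → (ℕ → Maybe ℕ) → Parity → Vec (Fin m) m → Bool
isPermAvoiding f p σ = distinct σ ∧ (avoidsAll f σ ∧ does (parity (inversions σ) ≟ p))

#perms : (ℕ → Maybe ℕ) → ℕ → Parity → ℕ
#perms f m p = #words m m (isPermAvoiding f p)

#perms-cong : ∀ {f g} m p → (∀ i → f i ≡ g i) → #perms f m p ≡ #perms g m p
#perms-cong m p f≗g = #words-cong m m (λ σ → cong (λ b → distinct σ ∧ (b ∧ _)) (avoidsAll-cong f≗g σ))

isPermAvoiding-∷-punchIn : ∀ {m} f p (a : Fin (suc m)) (w : Vec (Fin m) m) →
  isPermAvoiding f p (a ∷ vmap (punchIn a) w)
    ≡ (if avoids (f 0) (toℕ a)
       then isPermAvoiding (forbiddenAfter f (toℕ a)) (parity (toℕ a) ℙ.+ p) w else false)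
isPermAvoiding-∷-punchIn f p a w
  rewrite pivot-∉ᵇ-punchIn a w | distinct-punchIn a w | avoidsAll-punchIn a (f ∘ suc) w
        | #below-pivot-punchIn a w | inversions-punchIn a w
  with distinct w in dist
... | false with avoids (f 0) (toℕ a)
...   | true  = refl
...   | false = refl
isPermAvoiding-∷-punchIn f p a w | true
  rewrite #below-distinct (toℕ a) w (subst T (sym dist) tt) (toℕ≤pred[n] a)
        | +-homo-+ (toℕ a) (inversions w) | ≟-+-transpose (parity (toℕ a)) (parity (inversions w)) p
  with avoids (f 0) (toℕ a)
... | true  = refl
... | false = refl

#perms-suc : ∀ f m p → #perms f (suc m) p ≡
  ∑[ a < suc m ] (if avoids (f 0) (toℕ a) then #perms (forbiddenAfter f (toℕ a)) m (parity (toℕ a) ℙ.+ p) else 0)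
#perms-suc f m p = trans (#words-∷ m (suc m) (isPermAvoiding f p)) (sum-cong-≗ first-entry)
  where
  first-entry : ∀ a → #words m (suc m) (λ w → isPermAvoiding f p (a ∷ w))
    ≡ (if avoids (f 0) (toℕ a) then #perms (forbiddenAfter f (toℕ a)) m (parity (toℕ a) ℙ.+ p) else 0)
  first-entry a = begin
      #words m (suc m) (λ w → isPermAvoiding f p (a ∷ w))
    ≡⟨ #words-punchIn m m a _ repeated-first-entry ⟩
      #words m m (λ w → isPermAvoiding f p (a ∷ vmap (punchIn a) w))
    ≡⟨ #words-cong m m (isPermAvoiding-∷-punchIn f p a) ⟩
      #words m m (λ w → if avoids (f 0) (toℕ a) then isPermAvoiding (forbiddenAfter f (toℕ a)) _ w else false)
    ≡⟨ #words-if m m (avoids (f 0) (toℕ a)) _ ⟩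
      (if avoids (f 0) (toℕ a) then #perms (forbiddenAfter f (toℕ a)) m (parity (toℕ a) ℙ.+ p) else 0)
    ∎
    where
    open ≡-Reasoning
    repeated-first-entry : ∀ w → T (a ∈ᵇ w) → isPermAvoiding f p (a ∷ w) ≡ false
    repeated-first-entry w a∈w rewrite Equivalence.to T-≡ a∈w = refl

#perms-swapIndex : ∀ f m p j → suc j < m → #perms f m p ≡ #perms (f ∘ swapIndex j) m (p ⁻¹)
#perms-swapIndex f m p j j+1<m =
  trans (sym (#words-swapAdjacent j m m (isPermAvoiding f p))) (#words-cong m m swapped)
  where
  swapped : ∀ σ → isPermAvoiding f p (swapAdjacent j σ) ≡ isPermAvoiding (f ∘ swapIndex j) (p ⁻¹) σ
  swapped σ rewrite distinct-swapAdjacent j σ | avoidsAll-swapAdjacent j f σ j+1<m with distinct σ in dist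
  ... | false = refl
  ... | true rewrite parity-inversions-swapAdjacent j σ j+1<m (subst T (sym dist) tt) =
    cong (avoidsAll (f ∘ swapIndex j) σ ∧_) (≟-+-transpose 1ℙ (parity (inversions σ)) p)

#derangements : ℕ → Parity → ℕ
#derangements = #perms just

-- What remains of the derangement condition once the first entry is q + 1: the old
-- position q + 1, now q, is unconstrained.
afterFirst : ℕ → ℕ → Maybe ℕ
afterFirst q = forbiddenAfter just (suc q)

afterFirst-swapIndex : ∀ q i → afterFirst (suc q) (swapIndex q i) ≡ afterFirst q i
afterFirst-swapIndex zero    zero          = refl
afterFirst-swapIndex zero    (suc zero)    = refl
afterFirst-swapIndex zero    (suc (suc i)) = refl
afterFirst-swapIndex (suc q) zero          = refl
afterFirst-swapIndex (suc q) (suc i)       = cong (Maybe.map suc) (afterFirst-swapIndex q i)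

#perms-afterFirst : ∀ q m p → q < m → #perms (afterFirst q) m p ≡ #perms (afterFirst 0) m (parity q ℙ.+ p)
#perms-afterFirst zero    m p _     = refl
#perms-afterFirst (suc q) m p q+1<m = begin
    #perms (afterFirst (suc q)) m p
  ≡⟨ #perms-swapIndex (afterFirst (suc q)) m p q q+1<m ⟩
    #perms (afterFirst (suc q) ∘ swapIndex q) m (p ⁻¹)
  ≡⟨ #perms-cong m (p ⁻¹) (afterFirst-swapIndex q) ⟩
    #perms (afterFirst q) m (p ⁻¹)
  ≡⟨ #perms-afterFirst q m (p ⁻¹) (<-trans (n<1+n q) q+1<m) ⟩
    #perms (afterFirst 0) m (parity q ℙ.+ p ⁻¹)
  ≡⟨ cong (#perms (afterFirst 0) m)
          (trans (sym (⁻¹-+-comm (parity q) p)) (cong (ℙ._+ p) (sym (parity-suc q)))) ⟩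
    #perms (afterFirst 0) m (parity (suc q) ℙ.+ p)
  ∎
  where open ≡-Reasoning

∑-#perms-afterFirst : ∀ m p →
  ∑[ q < m ] #perms (afterFirst (toℕ q)) m (parity (suc (toℕ q)) ℙ.+ p) ≡ m * #perms (afterFirst 0) m (p ⁻¹)
∑-#perms-afterFirst m p = trans (sum-cong-≗ term) (trans (sum-replicate m) (×≡* m _))
  where
  term : ∀ (q : Fin m) →
    #perms (afterFirst (toℕ q)) m (parity (suc (toℕ q)) ℙ.+ p) ≡ #perms (afterFirst 0) m (p ⁻¹)
  term q = trans (#perms-afterFirst (toℕ q) m _ (toℕ<n q))
                 (cong (#perms (afterFirst 0) m) (parity-cancel (toℕ q)))
    where
    parity-cancel : ∀ t → parity t ℙ.+ (parity (suc t) ℙ.+ p) ≡ p ⁻¹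
    parity-cancel t rewrite parity-suc t with parity t
    ... | 0ℙ = refl
    ... | 1ℙ = refl
  ×≡* : ∀ k x → k ×ℕ x ≡ k * x
  ×≡* zero    x = refl
  ×≡* (suc k) x = cong (x +_) (×≡* k x)

#derangements-suc : ∀ m p → #derangements (suc m) p ≡ m * #perms (afterFirst 0) m (p ⁻¹)
#derangements-suc m p = trans (#perms-suc just m p) (∑-#perms-afterFirst m p)

#perms-afterFirst0-suc : ∀ m p →
  #perms (afterFirst 0) (suc m) p ≡ #derangements m p + m * #perms (afterFirst 0) m (p ⁻¹)
#perms-afterFirst0-suc m p =
  trans (#perms-suc (afterFirst 0) m p) (cong (#derangements m p +_) (∑-#perms-afterFirst m p))

#derangements-rec : ∀ m p →
  #derangements (2 + m) p ≡ (1 + m) * (#derangements (1 + m) (p ⁻¹) + #derangements m (p ⁻¹))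
#derangements-rec m p = begin
    #derangements (2 + m) p
  ≡⟨ #derangements-suc (suc m) p ⟩
    (1 + m) * #perms (afterFirst 0) (suc m) (p ⁻¹)
  ≡⟨ cong ((1 + m) *_) (#perms-afterFirst0-suc m (p ⁻¹)) ⟩
    (1 + m) * (#derangements m (p ⁻¹) + m * #perms (afterFirst 0) m (p ⁻¹ ⁻¹))
  ≡⟨ cong (λ x → (1 + m) * (#derangements m (p ⁻¹) + x)) (#derangements-suc m (p ⁻¹)) ⟨
    (1 + m) * (#derangements m (p ⁻¹) + #derangements (1 + m) (p ⁻¹))
  ≡⟨ cong ((1 + m) *_) (+-comm (#derangements m (p ⁻¹)) _) ⟩
    (1 + m) * (#derangements (1 + m) (p ⁻¹) + #derangements m (p ⁻¹))
  ∎
  where open ≡-Reasoning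

-- Agreement with the definitions of dAS

module _ {n : ℕ} where

  lookup-∈ᵇ : ∀ {k} (w : Vec (Fin n) k) j → T (lookup w j ∈ᵇ w)
  lookup-∈ᵇ (a ∷ w) fzero    = Equivalence.from T-∨ (inj₁ (≡⇒≡ᵇ (toℕ a) (toℕ a) refl))
  lookup-∈ᵇ (a ∷ w) (fsuc j) = Equivalence.from T-∨ (inj₂ (lookup-∈ᵇ w j))

  ∈ᵇ⇒lookup : ∀ {k} a (w : Vec (Fin n) k) → T (a ∈ᵇ w) → ∃ λ j → lookup w j ≡ a
  ∈ᵇ⇒lookup a (x ∷ w) a∈x∷w with Equivalence.to T-∨ a∈x∷w
  ... | inj₁ a≡x = fzero , sym (toℕ-injective (≡ᵇ⇒≡ _ _ a≡x))
  ... | inj₂ a∈w = Product.map fsuc id (∈ᵇ⇒lookup a w a∈w)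

  Injective : ∀ {k} → Vec (Fin n) k → Set
  Injective {k} w = (i j : Fin k) → lookup w i ≡ lookup w j → i ≡ j

  distinct-∷⇒∉ᵇ : ∀ {k} a (w : Vec (Fin n) k) → T (distinct (a ∷ w)) → ¬ T (a ∈ᵇ w)
  distinct-∷⇒∉ᵇ a w dist = Equivalence.to T-not (proj₁ (Equivalence.to (T-∧ {not (a ∈ᵇ w)}) dist))

  distinct⇒injective : ∀ {k} (w : Vec (Fin n) k) → T (distinct w) → Injective w
  distinct⇒injective (a ∷ w) dist fzero    fzero    _     = refl
  distinct⇒injective (a ∷ w) dist fzero    (fsuc j) a≡wⱼ =
    contradiction (subst (λ x → T (x ∈ᵇ w)) (sym a≡wⱼ) (lookup-∈ᵇ w j)) (distinct-∷⇒∉ᵇ a w dist)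
  distinct⇒injective (a ∷ w) dist (fsuc i) fzero    wᵢ≡a =
    contradiction (subst (λ x → T (x ∈ᵇ w)) wᵢ≡a (lookup-∈ᵇ w i)) (distinct-∷⇒∉ᵇ a w dist)
  distinct⇒injective (a ∷ w) dist (fsuc i) (fsuc j) wᵢ≡wⱼ =
    cong fsuc (distinct⇒injective w (proj₂ (Equivalence.to (T-∧ {not (a ∈ᵇ w)}) dist)) i j wᵢ≡wⱼ)

  injective⇒distinct : ∀ {k} (w : Vec (Fin n) k) → Injective w → T (distinct w)
  injective⇒distinct []      inj = tt
  injective⇒distinct (a ∷ w) inj = Equivalence.from T-∧
    ( Equivalence.from T-not (λ a∈w → let j , wⱼ≡a = ∈ᵇ⇒lookup a w a∈w
                                      in 0≢1+n (inj fzero (fsuc j) (sym wⱼ≡a)))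
    , injective⇒distinct w (λ i j wᵢ≡wⱼ → suc-injective (inj (fsuc i) (fsuc j) wᵢ≡wⱼ)) )

  avoidsAll⇒lookup : ∀ {k} f (w : Vec (Fin n) k) → T (avoidsAll f w) →
    ∀ i → T (avoids (f (toℕ i)) (toℕ (lookup w i)))
  avoidsAll⇒lookup f (a ∷ w) ok fzero    = proj₁ (Equivalence.to T-∧ ok)
  avoidsAll⇒lookup f (a ∷ w) ok (fsuc i) =
    avoidsAll⇒lookup (f ∘ suc) w (proj₂ (Equivalence.to (T-∧ {avoids (f 0) (toℕ a)}) ok)) i

  lookup⇒avoidsAll : ∀ {k} f (w : Vec (Fin n) k) →
    (∀ i → T (avoids (f (toℕ i)) (toℕ (lookup w i)))) → T (avoidsAll f w)
  lookup⇒avoidsAll f []      _  = tt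
  lookup⇒avoidsAll f (a ∷ w) ok = Equivalence.from T-∧ (ok fzero , lookup⇒avoidsAll (f ∘ suc) w (ok ∘ fsuc))

does-isPerm? : ∀ {n} (σ : Vec (Fin n) n) → does (isPerm? σ) ≡ distinct σ
does-isPerm? σ = does-≡ (isPerm? σ) (distinct⇒injective σ) (injective⇒distinct σ)

does-isDerangement? : ∀ {n} (σ : Vec (Fin n) n) → does (isDerangement? σ) ≡ avoidsAll just σ
does-isDerangement? σ = does-≡ (isDerangement? σ)
  (λ ok i σᵢ≡i → Equivalence.to T-not (avoidsAll⇒lookup just σ ok i) (≡⇒≡ᵇ _ _ (cong toℕ σᵢ≡i)))
  (λ der → lookup⇒avoidsAll just σ (λ i → Equivalence.from T-not (der i ∘ toℕ-injective ∘ ≡ᵇ⇒≡ _ _)))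

module _ {n : ℕ} where

  #entries-∑ : ∀ {k} P (w : Vec (Fin n) k) →
    #entries P w ≡ ∑[ j < k ] (if P (toℕ (lookup w j)) then 1 else 0)
  #entries-∑ P []      = refl
  #entries-∑ P (a ∷ w) with P (toℕ a)
  ... | true  = cong suc (#entries-∑ P w)
  ... | false = #entries-∑ P w

  inversions-∑ : ∀ {k} (w : Vec (Fin n) k) →
    inversions w
      ≡ ∑[ i < k ] ∑[ j < k ] (if (toℕ i <ᵇ toℕ j) ∧ (toℕ (lookup w j) <ᵇ toℕ (lookup w i)) then 1 else 0)
  inversions-∑ []      = refl
  inversions-∑ (a ∷ w) = cong₂ _+_ (#entries-∑ (_<ᵇ toℕ a) w) (inversions-∑ w)

inv≡inversions : ∀ {n} (σ : Vec (Fin n) n) → inv σ ≡ inversions σ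
inv≡inversions {n} σ = begin
    inv σ
  ≡⟨ length-filter _ (allPairs n) ⟩
    count isInversion (allPairs n)
  ≡⟨ count-concatMap-tabulate isInversion (λ i → map (i ,_) (allFin n)) n id ⟩
    ∑[ i < n ] count isInversion (map (i ,_) (allFin n))
  ≡⟨ sum-cong-≗ (λ i → trans (count-map isInversion (i ,_) (allFin n))
                             (count-tabulate (isInversion ∘ (i ,_)) n id)) ⟩
    ∑[ i < n ] ∑[ j < n ] (if isInversion (i , j) then 1 else 0)
  ≡⟨ inversions-∑ σ ⟨
    inversions σ
  ∎
  where
  open ≡-Reasoning
  isInversion : Fin n × Fin n → Bool
  isInversion (i , j) = (toℕ i <ᵇ toℕ j) ∧ (toℕ (lookup σ j) <ᵇ toℕ (lookup σ i))

does-%2≟0 : ∀ m → does ((m % 2) ℕ.≟ 0) ≡ does (parity m ≟ 0ℙ)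
does-%2≟0 zero          = refl
does-%2≟0 (suc zero)    = refl
does-%2≟0 (suc (suc m)) = does-%2≟0 m

dAS≡#derangements : ∀ n → dAS n ≡ #derangements n 0ℙ
dAS≡#derangements n = trans (length-filter _ (allWords n n)) (#words-cong n n test)
  where
  test : ∀ σ →
    does (isPerm? σ) ∧ (does (isDerangement? σ) ∧ does (evenLength? σ)) ≡ isPermAvoiding just 0ℙ σ
  test σ rewrite does-isPerm? σ | does-isDerangement? σ | does-%2≟0 (inv σ) | inv≡inversions σ = refl

ℕtoℚ-canonical : ∀ m → ℕtoℚ m ≡ mkℚ (ℤ.+ m) 0 (Coprime.sym (Coprime.1-coprimeTo m))
ℕtoℚ-canonical m = ℚ.normalize-coprime (Coprime.sym (Coprime.1-coprimeTo m))

ℕtoℚ-+ : ∀ a b → ℕtoℚ (a + b) ≡ ℕtoℚ a +ℚ ℕtoℚ b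
ℕtoℚ-+ a b rewrite ℕtoℚ-canonical a | ℕtoℚ-canonical b =
  ℚ./-cong (trans (ℤ.pos-+ a b) (sym (cong₂ ℤ._+_ (ℤ.*-identityʳ (ℤ.+ a)) (ℤ.*-identityʳ (ℤ.+ b))))) refl

ℕtoℚ-* : ∀ a b → ℕtoℚ (a * b) ≡ ℕtoℚ a *ℚ ℕtoℚ b
ℕtoℚ-* a b rewrite ℕtoℚ-canonical a | ℕtoℚ-canonical b = ℚ./-cong (ℤ.pos-* a b) refl

ℕtoℚ-suc : ∀ m → ℕtoℚ (suc m) ≡ 1ℚ +ℚ ℕtoℚ m
ℕtoℚ-suc = ℕtoℚ-+ 1

factorial-invFact : ∀ k → ℕtoℚ (k !) *ℚ invFact k ≡ 1ℚ
factorial-invFact k with k ! | k !≢0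
... | suc d | _ rewrite ℕtoℚ-canonical (suc d) | ℚ.normalize-coprime {1} {d} (Coprime.1-coprimeTo (suc d)) =
  ℚ.*-inverseʳ (mkℚ (ℤ.+ suc d) 0 (Coprime.sym (Coprime.1-coprimeTo (suc d))))

foldr-+-init : ∀ (g : ℕ → ℚ) z xs →
  foldr (λ k acc → g k +ℚ acc) z xs ≡ foldr (λ k acc → g k +ℚ acc) 0ℚ xs +ℚ z
foldr-+-init g z []       = sym (ℚ.+-identityˡ z)
foldr-+-init g z (x ∷ xs) = trans (cong (g x +ℚ_) (foldr-+-init g z xs)) (sym (ℚ.+-assoc (g x) _ z))

altSum-suc : ∀ k → altSum (suc k) ≡ altSum k +ℚ signℚ (suc k) *ℚ invFact (suc k)
altSum-suc k = begin
    foldr f 0ℚ (upTo (2 + k))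
  ≡⟨ cong (foldr f 0ℚ) (upTo-∷ʳ (suc k)) ⟨
    foldr f 0ℚ (upTo (suc k) ∷ʳ suc k)
  ≡⟨ foldr-∷ʳ f 0ℚ (suc k) (upTo (suc k)) ⟩
    foldr f (term (suc k) +ℚ 0ℚ) (upTo (suc k))
  ≡⟨ foldr-+-init term _ (upTo (suc k)) ⟩
    altSum k +ℚ (term (suc k) +ℚ 0ℚ)
  ≡⟨ cong (altSum k +ℚ_) (ℚ.+-identityʳ (term (suc k))) ⟩
    altSum k +ℚ term (suc k)
  ∎
  where
  open ≡-Reasoning
  term : ℕ → ℚ
  term j = signℚ j *ℚ invFact j
  f : ℕ → ℚ → ℚ
  f j acc = term j +ℚ acc

-- The coupled recurrence over ℚ

⟦_⟧ : ℕ → ℚ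
⟦_⟧ = ℕtoℚ

module CoupledRecurrence (e o : ℕ → ℕ)
  (e-rec : ∀ m → e (2 + m) ≡ (1 + m) * (o (1 + m) + o m))
  (o-rec : ∀ m → o (2 + m) ≡ (1 + m) * (e (1 + m) + e m))
  (e₀ : e 0 ≡ 1) (o₀ : o 0 ≡ 0) (e₁ : e 1 ≡ 0) (o₁ : o 1 ≡ 0) where

  E O D Δ : ℕ → ℚ
  E m = ⟦ e m ⟧
  O m = ⟦ o m ⟧
  D m = E m +ℚ O m
  Δ m = E m +ℚ - O m

  recurrence-ℚ : ∀ (f g : ℕ → ℕ) → (∀ m → f (2 + m) ≡ (1 + m) * (g (1 + m) + g m)) →
    ∀ m → ⟦ f (2 + m) ⟧ ≡ ⟦ 1 + m ⟧ *ℚ (⟦ g (1 + m) ⟧ +ℚ ⟦ g m ⟧)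
  recurrence-ℚ f g f-rec m = begin
    ⟦ f (2 + m) ⟧                          ≡⟨ cong ⟦_⟧ (f-rec m) ⟩
    ⟦ (1 + m) * (g (1 + m) + g m) ⟧        ≡⟨ ℕtoℚ-* (1 + m) (g (1 + m) + g m) ⟩
    ⟦ 1 + m ⟧ *ℚ ⟦ g (1 + m) + g m ⟧       ≡⟨ cong (⟦ 1 + m ⟧ *ℚ_) (ℕtoℚ-+ (g (1 + m)) (g m)) ⟩
    ⟦ 1 + m ⟧ *ℚ (⟦ g (1 + m) ⟧ +ℚ ⟦ g m ⟧) ∎
    where open ≡-Reasoning

  D-rec : ∀ m → D (2 + m) ≡ ⟦ 1 + m ⟧ *ℚ (D (1 + m) +ℚ D m)
  D-rec m rewrite recurrence-ℚ e o e-rec m | recurrence-ℚ o e o-rec m =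
    solve 5 (λ x a b c d → x :* (c :+ d) :+ x :* (a :+ b) := x :* ((a :+ c) :+ (b :+ d))) refl
      ⟦ 1 + m ⟧ (E (1 + m)) (E m) (O (1 + m)) (O m)

  Δ-rec : ∀ m → Δ (2 + m) ≡ - (⟦ 1 + m ⟧ *ℚ (Δ (1 + m) +ℚ Δ m))
  Δ-rec m rewrite recurrence-ℚ e o e-rec m | recurrence-ℚ o e o-rec m =
    solve 5 (λ x a b c d → x :* (c :+ d) :+ :- (x :* (a :+ b)) := :- (x :* ((a :+ :- c) :+ (b :+ :- d)))) refl
      ⟦ 1 + m ⟧ (E (1 + m)) (E m) (O (1 + m)) (O m)

  Δ-closed : ∀ m → Δ (1 + m) ≡ signℚ m *ℚ ⟦ m ⟧
  Δ-closed zero          rewrite e₁ | o₁ = refl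
  Δ-closed (suc zero)    rewrite Δ-rec 0 | e₁ | o₁ | e₀ | o₀ = refl
  Δ-closed (suc (suc m)) = begin
      Δ (3 + m)
    ≡⟨ Δ-rec (1 + m) ⟩
      - (y *ℚ (Δ (2 + m) +ℚ Δ (1 + m)))
    ≡⟨ cong₂ (λ a b → - (y *ℚ (a +ℚ b))) (Δ-closed (suc m)) (Δ-closed m) ⟩
      - (y *ℚ (- s *ℚ ⟦ 1 + m ⟧ +ℚ s *ℚ x))
    ≡⟨ cong (λ a → - (y *ℚ (- s *ℚ a +ℚ s *ℚ x))) (ℕtoℚ-suc m) ⟩
      - (y *ℚ (- s *ℚ (1ℚ +ℚ x) +ℚ s *ℚ x))
    ≡⟨ solve 3 (λ y s x → :- (y :* ((:- s) :* (con 1ℚ :+ x) :+ s :* x)) := (:- (:- s)) :* y) refl y s x ⟩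
      signℚ (2 + m) *ℚ ⟦ 2 + m ⟧
    ∎
    where
    open ≡-Reasoning
    x = ⟦ m ⟧
    y = ⟦ 2 + m ⟧
    s = signℚ m

  D-rec₁ : ∀ m → D (1 + m) ≡ ⟦ 1 + m ⟧ *ℚ D m +ℚ signℚ (1 + m)
  D-rec₁ zero    rewrite e₁ | o₁ | e₀ | o₀ = refl
  D-rec₁ (suc m) = begin
      D (2 + m)
    ≡⟨ D-rec m ⟩
      x *ℚ (D (1 + m) +ℚ D m)
    ≡⟨ solve 4 (λ x d₁ d₀ s → x :* (d₁ :+ d₀) := x :* d₁ :+ (x :* d₀ :+ s) :+ :- s) refl
         x (D (1 + m)) (D m) s ⟩
      x *ℚ D (1 + m) +ℚ (x *ℚ D m +ℚ s) +ℚ - s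
    ≡⟨ cong (λ a → x *ℚ D (1 + m) +ℚ a +ℚ - s) (D-rec₁ m) ⟨
      x *ℚ D (1 + m) +ℚ D (1 + m) +ℚ - s
    ≡⟨ solve 3 (λ x d₁ s → x :* d₁ :+ d₁ :+ s := (con 1ℚ :+ x) :* d₁ :+ s) refl x (D (1 + m)) (- s) ⟩
      (1ℚ +ℚ x) *ℚ D (1 + m) +ℚ - s
    ≡⟨ cong (λ a → a *ℚ D (1 + m) +ℚ - s) (ℕtoℚ-suc (1 + m)) ⟨
      ⟦ 2 + m ⟧ *ℚ D (1 + m) +ℚ signℚ (2 + m)
    ∎
    where
    open ≡-Reasoning
    x = ⟦ 1 + m ⟧
    s = signℚ (1 + m)

  D≡factorial*altSum : ∀ m → D m ≡ ⟦ m ! ⟧ *ℚ altSum m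
  D≡factorial*altSum zero    rewrite e₀ | o₀ = refl
  D≡factorial*altSum (suc m) = begin
      D (1 + m)
    ≡⟨ D-rec₁ m ⟩
      x *ℚ D m +ℚ s
    ≡⟨ cong₂ (λ a b → x *ℚ a +ℚ b) (D≡factorial*altSum m)
             (sym (trans (cong (s *ℚ_) (factorial-invFact (1 + m))) (ℚ.*-identityʳ s))) ⟩
      x *ℚ (⟦ m ! ⟧ *ℚ altSum m) +ℚ s *ℚ (⟦ (1 + m) ! ⟧ *ℚ invFact (1 + m))
    ≡⟨ cong (λ a → x *ℚ (⟦ m ! ⟧ *ℚ altSum m) +ℚ s *ℚ (a *ℚ invFact (1 + m)))
            (ℕtoℚ-* (1 + m) (m !)) ⟩
      x *ℚ (⟦ m ! ⟧ *ℚ altSum m) +ℚ s *ℚ ((x *ℚ ⟦ m ! ⟧) *ℚ invFact (1 + m))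
    ≡⟨ solve 5 (λ x f a s i → x :* (f :* a) :+ s :* ((x :* f) :* i) := (x :* f) :* (a :+ s :* i)) refl
         x ⟦ m ! ⟧ (altSum m) s (invFact (1 + m)) ⟩
      (x *ℚ ⟦ m ! ⟧) *ℚ (altSum m +ℚ s *ℚ invFact (1 + m))
    ≡⟨ cong₂ _*ℚ_ (ℕtoℚ-* (1 + m) (m !)) (altSum-suc m) ⟨
      ⟦ (1 + m) ! ⟧ *ℚ altSum (1 + m)
    ∎
    where
    open ≡-Reasoning
    x = ⟦ 1 + m ⟧
    s = signℚ (1 + m)

  E≡half : ∀ m → E (1 + m) ≡ ½ *ℚ (D (1 + m) +ℚ signℚ m *ℚ ⟦ m ⟧)
  E≡half m = begin
      E (1 + m)
    ≡⟨ solve 2 (λ e o → e := con ½ :* ((e :+ o) :+ (e :+ :- o))) refl (E (1 + m)) (O (1 + m)) ⟩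
      ½ *ℚ (D (1 + m) +ℚ Δ (1 + m))
    ≡⟨ cong (λ a → ½ *ℚ (D (1 + m) +ℚ a)) (Δ-closed m) ⟩
      ½ *ℚ (D (1 + m) +ℚ signℚ m *ℚ ⟦ m ⟧)
    ∎
    where open ≡-Reasoning

  D-closed : ∀ k → D (2 + k) ≡ ⟦ (2 + k) ! ⟧ *ℚ altSum k +ℚ signℚ (1 + k) *ℚ ⟦ 1 + k ⟧
  D-closed k = begin
      D (2 + k)
    ≡⟨ D-rec₁ (1 + k) ⟩
      ⟦ 2 + k ⟧ *ℚ D (1 + k) +ℚ - - s
    ≡⟨ cong₂ (λ a b → a *ℚ b +ℚ - - s) (ℕtoℚ-suc (1 + k)) (D-rec₁ k) ⟩
      (1ℚ +ℚ x) *ℚ (x *ℚ D k +ℚ - s) +ℚ - - s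
    ≡⟨ cong (λ a → (1ℚ +ℚ x) *ℚ (x *ℚ a +ℚ - s) +ℚ - - s) (D≡factorial*altSum k) ⟩
      (1ℚ +ℚ x) *ℚ (x *ℚ (⟦ k ! ⟧ *ℚ altSum k) +ℚ - s) +ℚ - - s
    ≡⟨ solve 4 (λ x f a s → (con 1ℚ :+ x) :* (x :* (f :* a) :+ :- s) :+ :- (:- s)
                          := ((con 1ℚ :+ x) :* (x :* f)) :* a :+ (:- s) :* x) refl x ⟦ k ! ⟧ (altSum k) s ⟩
      ((1ℚ +ℚ x) *ℚ (x *ℚ ⟦ k ! ⟧)) *ℚ altSum k +ℚ - s *ℚ x
    ≡⟨ cong (λ a → a *ℚ altSum k +ℚ - s *ℚ x) factorial-2+k ⟨
      ⟦ (2 + k) ! ⟧ *ℚ altSum k +ℚ signℚ (1 + k) *ℚ ⟦ 1 + k ⟧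
    ∎
    where
    open ≡-Reasoning
    x = ⟦ 1 + k ⟧
    s = signℚ k
    factorial-2+k : ⟦ (2 + k) ! ⟧ ≡ (1ℚ +ℚ x) *ℚ (x *ℚ ⟦ k ! ⟧)
    factorial-2+k =
      trans (ℕtoℚ-* (2 + k) ((1 + k) !)) (cong₂ _*ℚ_ (ℕtoℚ-suc (1 + k)) (ℕtoℚ-* (1 + k) (k !)))

  formula-i : (n : ℕ) → 2 ≤ n →
    E n ≡ (⟦ n ! ⟧ *ℚ ½) *ℚ altSum (n ∸ 2) +ℚ signℚ (n ∸ 1) *ℚ ⟦ n ∸ 1 ⟧
  formula-i (suc zero)    (s≤s ())
  formula-i (suc (suc k)) _ = begin
      E (2 + k)
    ≡⟨ E≡half (1 + k) ⟩
      ½ *ℚ (D (2 + k) +ℚ s *ℚ x)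
    ≡⟨ cong (λ a → ½ *ℚ (a +ℚ s *ℚ x)) (D-closed k) ⟩
      ½ *ℚ ((f *ℚ altSum k +ℚ s *ℚ x) +ℚ s *ℚ x)
    ≡⟨ solve 4 (λ f a s x → con ½ :* ((f :* a :+ s :* x) :+ s :* x) := (f :* con ½) :* a :+ s :* x) refl
         f (altSum k) s x ⟩
      (f *ℚ ½) *ℚ altSum k +ℚ s *ℚ x
    ∎
    where
    open ≡-Reasoning
    f = ⟦ (2 + k) ! ⟧
    x = ⟦ 1 + k ⟧
    s = signℚ (1 + k)

  formula-ii : (n : ℕ) → 2 ≤ n →
    E n ≡ ⟦ n ⟧ *ℚ E (n ∸ 1) +ℚ ((signℚ (n ∸ 1) *ℚ ½) *ℚ (⟦ n ∸ 2 ⟧ *ℚ ⟦ n + 1 ⟧))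
  formula-ii (suc zero)    (s≤s ())
  formula-ii (suc (suc k)) _ = begin
      E (2 + k)
    ≡⟨ E≡half (1 + k) ⟩
      ½ *ℚ (D (2 + k) +ℚ - s *ℚ ⟦ 1 + k ⟧)
    ≡⟨ cong₂ (λ a b → ½ *ℚ (a +ℚ - s *ℚ b)) (D-rec₁ (1 + k)) (ℕtoℚ-suc k) ⟩
      ½ *ℚ ((y *ℚ D (1 + k) +ℚ - - s) +ℚ - s *ℚ (1ℚ +ℚ x))
    ≡⟨ solve 4 (λ y d s x → con ½ :* ((y :* d :+ :- (:- s)) :+ (:- s) :* (con 1ℚ :+ x))
                          := y :* (con ½ :* (d :+ s :* x)) :+ ((:- s) :* con ½) :* (x :* (y :+ con 1ℚ))) refl
         y (D (1 + k)) s x ⟩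
      y *ℚ (½ *ℚ (D (1 + k) +ℚ s *ℚ x)) +ℚ ((- s *ℚ ½) *ℚ (x *ℚ (y +ℚ 1ℚ)))
    ≡⟨ cong₂ (λ a b → y *ℚ a +ℚ ((- s *ℚ ½) *ℚ (x *ℚ b))) (E≡half k) (ℕtoℚ-+ (2 + k) 1) ⟨
      y *ℚ E (1 + k) +ℚ ((- s *ℚ ½) *ℚ (x *ℚ ⟦ 2 + k + 1 ⟧))
    ∎
    where
    open ≡-Reasoning
    x = ⟦ k ⟧
    y = ⟦ 2 + k ⟧
    s = signℚ k

  formula-iii : (n : ℕ) → 3 ≤ n →
    E n ≡ ⟦ n ∸ 1 ⟧ *ℚ (E (n ∸ 1) +ℚ E (n ∸ 2) +ℚ signℚ (n ∸ 1))
  formula-iii (suc zero)          (s≤s ())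
  formula-iii (suc (suc zero))    (s≤s (s≤s ()))
  formula-iii (suc (suc (suc k))) _ = begin
      E (3 + k)
    ≡⟨ E≡half (2 + k) ⟩
      ½ *ℚ (D (3 + k) +ℚ - - s *ℚ y)
    ≡⟨ cong (λ a → ½ *ℚ (a +ℚ - - s *ℚ y)) (D-rec (1 + k)) ⟩
      ½ *ℚ (y *ℚ (D (2 + k) +ℚ D (1 + k)) +ℚ - - s *ℚ y)
    ≡⟨ solve 5 (λ y d₂ d₁ s x → con ½ :* (y :* (d₂ :+ d₁) :+ (:- (:- s)) :* y)
                             := y :* ((con ½ :* (d₂ :+ (:- s) :* (con 1ℚ :+ x)) :+ con ½ :* (d₁ :+ s :* x))
                                      :+ :- (:- s))) refl
         y (D (2 + k)) (D (1 + k)) s x ⟩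
      y *ℚ ((½ *ℚ (D (2 + k) +ℚ - s *ℚ (1ℚ +ℚ x)) +ℚ ½ *ℚ (D (1 + k) +ℚ s *ℚ x)) +ℚ - - s)
    ≡⟨ cong₂ (λ a b → y *ℚ ((a +ℚ b) +ℚ - - s)) E₂ (E≡half k) ⟨
      y *ℚ (E (2 + k) +ℚ E (1 + k) +ℚ - - s)
    ∎
    where
    open ≡-Reasoning
    x = ⟦ k ⟧
    y = ⟦ 2 + k ⟧
    s = signℚ k
    E₂ : E (2 + k) ≡ ½ *ℚ (D (2 + k) +ℚ - s *ℚ (1ℚ +ℚ x))
    E₂ = trans (E≡half (1 + k)) (cong (λ a → ½ *ℚ (D (2 + k) +ℚ - s *ℚ a)) (ℕtoℚ-suc k))

dAS-rec : ∀ m → dAS (2 + m) ≡ (1 + m) * (#derangements (1 + m) 1ℙ + #derangements m 1ℙ)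
dAS-rec m = trans (dAS≡#derangements (2 + m)) (#derangements-rec m 0ℙ)

#odd-derangements-rec : ∀ m → #derangements (2 + m) 1ℙ ≡ (1 + m) * (dAS (1 + m) + dAS m)
#odd-derangements-rec m = trans (#derangements-rec m 1ℙ)
  (cong₂ (λ a b → (1 + m) * (a + b)) (sym (dAS≡#derangements (1 + m))) (sym (dAS≡#derangements m)))

theorem1p1 :
    ((n : ℕ) → 2 ≤ n →
      ℕtoℚ (dAS n) ≡ (ℕtoℚ (n !) *ℚ ½) *ℚ altSum (n ∸ 2) +ℚ signℚ (n ∸ 1) *ℚ ℕtoℚ (n ∸ 1))
    × ((n : ℕ) → 2 ≤ n →
      ℕtoℚ (dAS n) ≡ ℕtoℚ n *ℚ ℕtoℚ (dAS (n ∸ 1)) +ℚ ((signℚ (n ∸ 1) *ℚ ½) *ℚ (ℕtoℚ (n ∸ 2) *ℚ ℕtoℚ (n + 1))))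
    × (dAS 1 ≡ 0)
    × ((n : ℕ) → 3 ≤ n →
      ℕtoℚ (dAS n) ≡ ℕtoℚ (n ∸ 1) *ℚ (ℕtoℚ (dAS (n ∸ 1)) +ℚ ℕtoℚ (dAS (n ∸ 2)) +ℚ signℚ (n ∸ 1)))
    × (dAS 2 ≡ 0)
theorem1p1 = formula-i , formula-ii , refl , formula-iii , refl
  where
  open CoupledRecurrence dAS (λ m → #derangements m 1ℙ) dAS-rec #odd-derangements-rec refl refl refl refl
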